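{- Let $\mathcal C$ be the class of pseudo-Kleene lattices satisfying the quasi-equation: $x\land x'=0$ and $y\land y'=0$ imply $(x\land y)\land(x\land y)'=0$. Then the variety generated by $\mathcal C$ equals the variety of all pseudo-Kleene lattices.
   Context: A pseudo-Kleene lattice is an algebra $(A,\land,\lor,{}',0,1)$ with $(A,\land,\lor,0,1)$ a bounded lattice, ${}'$ an antitone involution ($x\le y\Rightarrow y'\le x'$, $x''=x$), and $x\land x'\leq y\lor y'$ for all $x,y$. -}

module Defs where

open import Level using (Level; _⊔_; suc)
open import Data.Nat using (ℕ)
open import Data.Product using (_×_)
open import Algebra.Core using (Op₁; Op₂)
open import Relation.Binary.Core using (Rel)
open import Algebra.Definitions using (Congruent₁)
open import Algebra.Lattice.Structures using (IsLattice)

record PseudoKleene (c ℓ : Level) : Set (suc (c ⊔ ℓ)) where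
  infixr 7 _∧_
  infixr 6 _∨_
  infix  4 _≈_ _≤_
  field
    Carrier   : Set c
    _≈_       : Rel Carrier ℓ
    _∨_       : Op₂ Carrier
    _∧_       : Op₂ Carrier
    _′        : Op₁ Carrier
    𝟘         : Carrier
    𝟙         : Carrier
    isLattice : IsLattice _≈_ _∨_ _∧_
  _≤_ : Rel Carrier ℓ
  x ≤ y = (x ∧ y) ≈ x
  field
    ∨-identityʳ : ∀ x → (x ∨ 𝟘) ≈ x
    ∧-identityʳ : ∀ x → (x ∧ 𝟙) ≈ x
    ′-cong      : Congruent₁ _≈_ _′
    ′-antitone  : ∀ {x y} → x ≤ y → (y ′) ≤ (x ′)
    ′-involutive : ∀ x → ((x ′) ′) ≈ x
    kleene      : ∀ x y → (x ∧ (x ′)) ≤ (y ∨ (y ′))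
  open IsLattice isLattice public

data Term : Set where
  var  : ℕ → Term
  _∧ₜ_ : Term → Term → Term
  _∨ₜ_ : Term → Term → Term
  _′ₜ  : Term → Term
  𝟘ₜ   : Term
  𝟙ₜ   : Term

module _ {c ℓ : Level} (A : PseudoKleene c ℓ) where
  open PseudoKleene A

  ⟦_⟧ : Term → (ℕ → Carrier) → Carrier
  ⟦ var i ⟧  ρ = ρ i
  ⟦ s ∧ₜ t ⟧ ρ = ⟦ s ⟧ ρ ∧ ⟦ t ⟧ ρ
  ⟦ s ∨ₜ t ⟧ ρ = ⟦ s ⟧ ρ ∨ ⟦ t ⟧ ρ
  ⟦ s ′ₜ ⟧   ρ = (⟦ s ⟧ ρ) ′
  ⟦ 𝟘ₜ ⟧     ρ = 𝟘
  ⟦ 𝟙ₜ ⟧     ρ = 𝟙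

  Satisfies : Term → Term → Set (c ⊔ ℓ)
  Satisfies s t = ∀ (ρ : ℕ → Carrier) → ⟦ s ⟧ ρ ≈ ⟦ t ⟧ ρ

  QuasiEq : Set (c ⊔ ℓ)
  QuasiEq = ∀ x y → (x ∧ (x ′)) ≈ 𝟘 → (y ∧ (y ′)) ≈ 𝟘 →
            ((x ∧ y) ∧ ((x ∧ y) ′)) ≈ 𝟘

HoldsIn𝒞 : (c ℓ : Level) → Term → Term → Set (suc (c ⊔ ℓ))
HoldsIn𝒞 c ℓ s t = ∀ (A : PseudoKleene c ℓ) → QuasiEq A → Satisfies A s t

HoldsInPKL : (c ℓ : Level) → Term → Term → Set (suc (c ⊔ ℓ))
HoldsInPKL c ℓ s t = ∀ (A : PseudoKleene c ℓ) → Satisfies A s t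

-- V(𝒞) = PKL, expressed (Birkhoff) as equality of equational theories:
-- an identity holds in every member of 𝒞 iff it holds in every PKL.
VarietyGeneratedEqualsPKL : (c ℓ : Level) → Set (suc (c ⊔ ℓ))
VarietyGeneratedEqualsPKL c ℓ =
  ∀ (s t : Term) → (HoldsIn𝒞 c ℓ s t → HoldsInPKL c ℓ s t) × (HoldsInPKL c ℓ s t → HoldsIn𝒞 c ℓ s t)

{-# OPTIONS --safe #-}

-- Every pseudo-Kleene lattice A is a homomorphic image of the ordinal sum 1 ⊕ A ⊕ 1
-- obtained by adjoining a new bottom and a new top: collapse them onto 0 and 1.
-- In 1 ⊕ A ⊕ 1 an element x with x ∧ x′ = 0 must be one of the two new bounds,
-- and these are closed under ∧, so 1 ⊕ A ⊕ 1 lies in 𝒞. Hence every identity of 𝒞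
-- holds in A; the other inclusion is trivial.

module Submission where

open import Defs
open import Level using (Level; _⊔_)
open import Function.Base using (_∘_)
open import Data.Nat using (ℕ)
open import Data.Product using (_,_)
open import Data.Unit.Polymorphic using (⊤; tt)
open import Data.Empty.Polymorphic using (⊥)
open import Relation.Binary.Core using (Rel)
open import Relation.Nullary.Construct.Add.Extrema using (_±; ⊥±; ⊤±; [_])
open import Algebra.Lattice.Bundles using (Lattice)
import Algebra.Definitions as Definitions
import Algebra.Lattice.Properties.Lattice as LatticeProperties
import Relation.Binary.Reasoning.Setoid as SetoidReasoning

module PseudoKleeneProperties {c ℓ : Level} (A : PseudoKleene c ℓ) where
  open PseudoKleene A
  open Definitions _≈_ using (LeftIdentity; LeftZero; RightZero)

  lattice : Lattice c ℓ
  lattice = record { isLattice = isLattice }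

  open LatticeProperties lattice public using (∧-idem; ∨-idem)
  open SetoidReasoning (Lattice.setoid lattice)

  ∨-identityˡ : LeftIdentity 𝟘 _∨_
  ∨-identityˡ x = trans (∨-comm 𝟘 x) (∨-identityʳ x)

  ∧-identityˡ : LeftIdentity 𝟙 _∧_
  ∧-identityˡ x = trans (∧-comm 𝟙 x) (∧-identityʳ x)

  ∧-zeroˡ : LeftZero 𝟘 _∧_
  ∧-zeroˡ x = begin
    𝟘 ∧ x        ≈⟨ ∧-congˡ (sym (∨-identityˡ x)) ⟩
    𝟘 ∧ (𝟘 ∨ x)  ≈⟨ ∧-absorbs-∨ 𝟘 x ⟩
    𝟘            ∎

  ∧-zeroʳ : RightZero 𝟘 _∧_
  ∧-zeroʳ x = trans (∧-comm x 𝟘) (∧-zeroˡ x)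

  ∨-zeroˡ : LeftZero 𝟙 _∨_
  ∨-zeroˡ x = begin
    𝟙 ∨ x        ≈⟨ sym (∧-identityˡ (𝟙 ∨ x)) ⟩
    𝟙 ∧ (𝟙 ∨ x)  ≈⟨ ∧-absorbs-∨ 𝟙 x ⟩
    𝟙            ∎

  ∨-zeroʳ : RightZero 𝟙 _∨_
  ∨-zeroʳ x = trans (∨-comm x 𝟙) (∨-zeroˡ x)

  𝟘′≈𝟙 : 𝟘 ′ ≈ 𝟙
  𝟘′≈𝟙 = begin
    𝟘 ′               ≈⟨ sym (∧-identityˡ (𝟘 ′)) ⟩
    𝟙 ∧ 𝟘 ′           ≈⟨ ∧-congʳ (sym (′-involutive 𝟙)) ⟩
    (𝟙 ′) ′ ∧ 𝟘 ′     ≈⟨ ′-antitone (∧-zeroˡ (𝟙 ′)) ⟩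
    (𝟙 ′) ′           ≈⟨ ′-involutive 𝟙 ⟩
    𝟙                 ∎

  𝟙′≈𝟘 : 𝟙 ′ ≈ 𝟘
  𝟙′≈𝟘 = trans (′-cong (sym 𝟘′≈𝟙)) (′-involutive 𝟘)

module _ {c₁ ℓ₁ c₂ ℓ₂ : Level} (B : PseudoKleene c₁ ℓ₁) (A : PseudoKleene c₂ ℓ₂) where
  private
    module B = PseudoKleene B
    module A = PseudoKleene A

  record IsHomomorphism (h : B.Carrier → A.Carrier) : Set (c₁ ⊔ ℓ₁ ⊔ ℓ₂) where
    field
      cong   : ∀ {x y} → x B.≈ y → h x A.≈ h y
      ∧-homo : ∀ x y → h (x B.∧ y) A.≈ h x A.∧ h y
      ∨-homo : ∀ x y → h (x B.∨ y) A.≈ h x A.∨ h y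
      ′-homo : ∀ x → h (x B.′) A.≈ h x A.′
      𝟘-homo : h B.𝟘 A.≈ A.𝟘
      𝟙-homo : h B.𝟙 A.≈ A.𝟙

  module _ {h : B.Carrier → A.Carrier} (hom : IsHomomorphism h) where
    open IsHomomorphism hom

    ⟦⟧-homo : ∀ s ρ → h (⟦ B ⟧ s ρ) A.≈ ⟦ A ⟧ s (h ∘ ρ)
    ⟦⟧-homo (var i)  ρ = A.refl
    ⟦⟧-homo (s ∧ₜ t) ρ = A.trans (∧-homo _ _) (A.∧-cong (⟦⟧-homo s ρ) (⟦⟧-homo t ρ))
    ⟦⟧-homo (s ∨ₜ t) ρ = A.trans (∨-homo _ _) (A.∨-cong (⟦⟧-homo s ρ) (⟦⟧-homo t ρ))
    ⟦⟧-homo (s ′ₜ)   ρ = A.trans (′-homo _) (A.′-cong (⟦⟧-homo s ρ))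
    ⟦⟧-homo 𝟘ₜ       ρ = 𝟘-homo
    ⟦⟧-homo 𝟙ₜ       ρ = 𝟙-homo

module _ {c ℓ : Level} (A : PseudoKleene c ℓ) where
  open PseudoKleene A

  ⟦⟧-cong : ∀ s {ρ σ : ℕ → Carrier} → (∀ i → ρ i ≈ σ i) → ⟦ A ⟧ s ρ ≈ ⟦ A ⟧ s σ
  ⟦⟧-cong (var i)  ρ≈σ = ρ≈σ i
  ⟦⟧-cong (s ∧ₜ t) ρ≈σ = ∧-cong (⟦⟧-cong s ρ≈σ) (⟦⟧-cong t ρ≈σ)
  ⟦⟧-cong (s ∨ₜ t) ρ≈σ = ∨-cong (⟦⟧-cong s ρ≈σ) (⟦⟧-cong t ρ≈σ)
  ⟦⟧-cong (s ′ₜ)   ρ≈σ = ′-cong (⟦⟧-cong s ρ≈σ)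
  ⟦⟧-cong 𝟘ₜ       ρ≈σ = refl
  ⟦⟧-cong 𝟙ₜ       ρ≈σ = refl

module _ {c₁ ℓ₁ c₂ ℓ₂ : Level} {B : PseudoKleene c₁ ℓ₁} {A : PseudoKleene c₂ ℓ₂} where
  private
    module B = PseudoKleene B
    module A = PseudoKleene A

  satisfies-homomorphicImage : ∀ {h} → IsHomomorphism B A h →
                               (g : A.Carrier → B.Carrier) → (∀ a → h (g a) A.≈ a) →
                               ∀ {s t} → Satisfies B s t → Satisfies A s t
  satisfies-homomorphicImage {h} hom g hg≈id {s} {t} s≈t ρ = begin
    ⟦ A ⟧ s ρ            ≈⟨ ⟦⟧-cong A s (A.sym ∘ hg≈id ∘ ρ) ⟩
    ⟦ A ⟧ s (h ∘ g ∘ ρ)  ≈⟨ A.sym (⟦⟧-homo B A hom s (g ∘ ρ)) ⟩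
    h (⟦ B ⟧ s (g ∘ ρ))  ≈⟨ IsHomomorphism.cong hom (s≈t (g ∘ ρ)) ⟩
    h (⟦ B ⟧ t (g ∘ ρ))  ≈⟨ ⟦⟧-homo B A hom t (g ∘ ρ) ⟩
    ⟦ A ⟧ t (h ∘ g ∘ ρ)  ≈⟨ ⟦⟧-cong A t (hg≈id ∘ ρ) ⟩
    ⟦ A ⟧ t ρ            ∎
    where open SetoidReasoning (Lattice.setoid (PseudoKleeneProperties.lattice A))

module AdjoinBounds {c ℓ : Level} (A : PseudoKleene c ℓ) where
  open PseudoKleene A
  open PseudoKleeneProperties A

  infix  4 _≈±_
  infixr 7 _∧±_
  infixr 6 _∨±_

  _≈±_ : Rel (Carrier ±) ℓ
  ⊥±    ≈± ⊥±    = ⊤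
  ⊤±    ≈± ⊤±    = ⊤
  [ a ] ≈± [ b ] = a ≈ b
  _     ≈± _     = ⊥

  _∧±_ : Carrier ± → Carrier ± → Carrier ±
  ⊥±    ∧± y     = ⊥±
  ⊤±    ∧± y     = y
  [ a ] ∧± ⊥±    = ⊥±
  [ a ] ∧± ⊤±    = [ a ]
  [ a ] ∧± [ b ] = [ a ∧ b ]

  _∨±_ : Carrier ± → Carrier ± → Carrier ±
  ⊥±    ∨± y     = y
  ⊤±    ∨± y     = ⊤±
  [ a ] ∨± ⊥±    = [ a ]
  [ a ] ∨± ⊤±    = ⊤±
  [ a ] ∨± [ b ] = [ a ∨ b ]

  _′± : Carrier ± → Carrier ±
  ⊥±    ′± = ⊤±
  ⊤±    ′± = ⊥±
  [ a ] ′± = [ a ′ ]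

  ≈±-refl : ∀ x → x ≈± x
  ≈±-refl ⊥±    = tt
  ≈±-refl ⊤±    = tt
  ≈±-refl [ a ] = refl

  ≈±-sym : ∀ {x y} → x ≈± y → y ≈± x
  ≈±-sym {⊥±}    {⊥±}    _   = tt
  ≈±-sym {⊤±}    {⊤±}    _   = tt
  ≈±-sym {[ a ]} {[ b ]} a≈b = sym a≈b

  ≈±-trans : ∀ {x y z} → x ≈± y → y ≈± z → x ≈± z
  ≈±-trans {⊥±}    {⊥±}    {⊥±}    _   _   = tt
  ≈±-trans {⊤±}    {⊤±}    {⊤±}    _   _   = tt
  ≈±-trans {[ a ]} {[ b ]} {[ d ]} a≈b b≈d = trans a≈b b≈d

  ∧±-comm : ∀ x y → x ∧± y ≈± y ∧± x
  ∧±-comm ⊥±    ⊥±    = tt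
  ∧±-comm ⊥±    ⊤±    = tt
  ∧±-comm ⊥±    [ b ] = tt
  ∧±-comm ⊤±    ⊥±    = tt
  ∧±-comm ⊤±    ⊤±    = tt
  ∧±-comm ⊤±    [ b ] = refl
  ∧±-comm [ a ] ⊥±    = tt
  ∧±-comm [ a ] ⊤±    = refl
  ∧±-comm [ a ] [ b ] = ∧-comm a b

  ∨±-comm : ∀ x y → x ∨± y ≈± y ∨± x
  ∨±-comm ⊥±    ⊥±    = tt
  ∨±-comm ⊥±    ⊤±    = tt
  ∨±-comm ⊥±    [ b ] = refl
  ∨±-comm ⊤±    ⊥±    = tt
  ∨±-comm ⊤±    ⊤±    = tt
  ∨±-comm ⊤±    [ b ] = tt
  ∨±-comm [ a ] ⊥±    = refl
  ∨±-comm [ a ] ⊤±    = tt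
  ∨±-comm [ a ] [ b ] = ∨-comm a b

  ∧±-assoc : ∀ x y z → (x ∧± y) ∧± z ≈± x ∧± (y ∧± z)
  ∧±-assoc ⊥±    y     z     = tt
  ∧±-assoc ⊤±    y     z     = ≈±-refl (y ∧± z)
  ∧±-assoc [ a ] ⊥±    z     = tt
  ∧±-assoc [ a ] ⊤±    z     = ≈±-refl ([ a ] ∧± z)
  ∧±-assoc [ a ] [ b ] ⊥±    = tt
  ∧±-assoc [ a ] [ b ] ⊤±    = refl
  ∧±-assoc [ a ] [ b ] [ d ] = ∧-assoc a b d

  ∨±-assoc : ∀ x y z → (x ∨± y) ∨± z ≈± x ∨± (y ∨± z)
  ∨±-assoc ⊥±    y     z     = ≈±-refl (y ∨± z)
  ∨±-assoc ⊤±    y     z     = tt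
  ∨±-assoc [ a ] ⊥±    z     = ≈±-refl ([ a ] ∨± z)
  ∨±-assoc [ a ] ⊤±    z     = tt
  ∨±-assoc [ a ] [ b ] ⊥±    = refl
  ∨±-assoc [ a ] [ b ] ⊤±    = tt
  ∨±-assoc [ a ] [ b ] [ d ] = ∨-assoc a b d

  ∧±-cong : ∀ {x y u v} → x ≈± y → u ≈± v → x ∧± u ≈± y ∧± v
  ∧±-cong {⊥±}    {⊥±}                    _   _   = tt
  ∧±-cong {⊤±}    {⊤±}                    _   u≈v = u≈v
  ∧±-cong {[ a ]} {[ b ]} {⊥±}    {⊥±}    _   _   = tt
  ∧±-cong {[ a ]} {[ b ]} {⊤±}    {⊤±}    a≈b _   = a≈b
  ∧±-cong {[ a ]} {[ b ]} {[ _ ]} {[ _ ]} a≈b u≈v = ∧-cong a≈b u≈v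

  ∨±-cong : ∀ {x y u v} → x ≈± y → u ≈± v → x ∨± u ≈± y ∨± v
  ∨±-cong {⊥±}    {⊥±}                    _   u≈v = u≈v
  ∨±-cong {⊤±}    {⊤±}                    _   _   = tt
  ∨±-cong {[ a ]} {[ b ]} {⊥±}    {⊥±}    a≈b _   = a≈b
  ∨±-cong {[ a ]} {[ b ]} {⊤±}    {⊤±}    _   _   = tt
  ∨±-cong {[ a ]} {[ b ]} {[ _ ]} {[ _ ]} a≈b u≈v = ∨-cong a≈b u≈v

  ∨±-absorbs-∧± : ∀ x y → x ∨± (x ∧± y) ≈± x
  ∨±-absorbs-∧± ⊥±    y     = tt
  ∨±-absorbs-∧± ⊤±    y     = tt
  ∨±-absorbs-∧± [ a ] ⊥±    = refl
  ∨±-absorbs-∧± [ a ] ⊤±    = ∨-idem a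
  ∨±-absorbs-∧± [ a ] [ b ] = ∨-absorbs-∧ a b

  ∧±-absorbs-∨± : ∀ x y → x ∧± (x ∨± y) ≈± x
  ∧±-absorbs-∨± ⊥±    y     = tt
  ∧±-absorbs-∨± ⊤±    y     = tt
  ∧±-absorbs-∨± [ a ] ⊥±    = ∧-idem a
  ∧±-absorbs-∨± [ a ] ⊤±    = refl
  ∧±-absorbs-∨± [ a ] [ b ] = ∧-absorbs-∨ a b

  ′±-cong : ∀ {x y} → x ≈± y → x ′± ≈± y ′±
  ′±-cong {⊥±}    {⊥±}    _   = tt
  ′±-cong {⊤±}    {⊤±}    _   = tt
  ′±-cong {[ a ]} {[ b ]} a≈b = ′-cong a≈b

  ′±-involutive : ∀ x → (x ′±) ′± ≈± x
  ′±-involutive ⊥±    = tt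
  ′±-involutive ⊤±    = tt
  ′±-involutive [ a ] = ′-involutive a

  ′±-antitone : ∀ {x y} → x ∧± y ≈± x → y ′± ∧± x ′± ≈± y ′±
  ′±-antitone {⊥±}    {⊥±}    _   = tt
  ′±-antitone {⊥±}    {⊤±}    _   = tt
  ′±-antitone {⊥±}    {[ b ]} _   = refl
  ′±-antitone {⊤±}    {⊥±}    ()
  ′±-antitone {⊤±}    {⊤±}    _   = tt
  ′±-antitone {⊤±}    {[ b ]} ()
  ′±-antitone {[ a ]} {⊤±}    _   = tt
  ′±-antitone {[ a ]} {[ b ]} a≤b = ′-antitone a≤b

  kleene± : ∀ x y → (x ∧± x ′±) ∧± (y ∨± y ′±) ≈± x ∧± x ′±
  kleene± ⊥±    y     = tt
  kleene± ⊤±    y     = tt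
  kleene± [ a ] ⊥±    = refl
  kleene± [ a ] ⊤±    = refl
  kleene± [ a ] [ b ] = kleene a b

  adjoinBounds : PseudoKleene c ℓ
  adjoinBounds = record
    { Carrier      = Carrier ±
    ; _≈_          = _≈±_
    ; _∨_          = _∨±_
    ; _∧_          = _∧±_
    ; _′           = _′±
    ; 𝟘            = ⊥±
    ; 𝟙            = ⊤±
    ; isLattice    = record
      { isEquivalence = record
        { refl  = λ {x} → ≈±-refl x
        ; sym   = λ {x y} → ≈±-sym {x} {y}
        ; trans = λ {x y z} → ≈±-trans {x} {y} {z}
        }
      ; ∨-comm     = ∨±-comm
      ; ∨-assoc    = ∨±-assoc
      ; ∨-cong     = λ {x y u v} → ∨±-cong {x} {y} {u} {v}
      ; ∧-comm     = ∧±-comm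
      ; ∧-assoc    = ∧±-assoc
      ; ∧-cong     = λ {x y u v} → ∧±-cong {x} {y} {u} {v}
      ; absorptive = ∨±-absorbs-∧± , ∧±-absorbs-∨±
      }
    ; ∨-identityʳ  = λ x → ∨±-comm x ⊥±
    ; ∧-identityʳ  = λ x → ∧±-comm x ⊤±
    ; ′-cong       = λ {x y} → ′±-cong {x} {y}
    ; ′-antitone   = λ {x y} → ′±-antitone {x} {y}
    ; ′-involutive = ′±-involutive
    ; kleene       = kleene±
    }

  -- For x = [ a ], x ∧± x ′± = [ a ∧ a ′ ] is never ≈± ⊥±, so only the new bounds remain.
  adjoinBounds-quasiEq : QuasiEq adjoinBounds
  adjoinBounds-quasiEq ⊥± ⊥± _ _ = tt
  adjoinBounds-quasiEq ⊥± ⊤± _ _ = tt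
  adjoinBounds-quasiEq ⊤± ⊥± _ _ = tt
  adjoinBounds-quasiEq ⊤± ⊤± _ _ = tt

  collapse : Carrier ± → Carrier
  collapse ⊥±    = 𝟘
  collapse ⊤±    = 𝟙
  collapse [ a ] = a

  collapse-isHomomorphism : IsHomomorphism adjoinBounds A collapse
  collapse-isHomomorphism = record
    { cong   = λ {x y} → cong {x} {y}
    ; ∧-homo = ∧-homo
    ; ∨-homo = ∨-homo
    ; ′-homo = ′-homo
    ; 𝟘-homo = refl
    ; 𝟙-homo = refl
    }
    where
    cong : ∀ {x y} → x ≈± y → collapse x ≈ collapse y
    cong {⊥±}    {⊥±}    _   = refl
    cong {⊤±}    {⊤±}    _   = refl
    cong {[ a ]} {[ b ]} a≈b = a≈b

    ∧-homo : ∀ x y → collapse (x ∧± y) ≈ collapse x ∧ collapse y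
    ∧-homo ⊥±    y     = sym (∧-zeroˡ (collapse y))
    ∧-homo ⊤±    y     = sym (∧-identityˡ (collapse y))
    ∧-homo [ a ] ⊥±    = sym (∧-zeroʳ a)
    ∧-homo [ a ] ⊤±    = sym (∧-identityʳ a)
    ∧-homo [ a ] [ b ] = refl

    ∨-homo : ∀ x y → collapse (x ∨± y) ≈ collapse x ∨ collapse y
    ∨-homo ⊥±    y     = sym (∨-identityˡ (collapse y))
    ∨-homo ⊤±    y     = sym (∨-zeroˡ (collapse y))
    ∨-homo [ a ] ⊥±    = sym (∨-identityʳ a)
    ∨-homo [ a ] ⊤±    = sym (∨-zeroʳ a)
    ∨-homo [ a ] [ b ] = refl

    ′-homo : ∀ x → collapse (x ′±) ≈ collapse x ′
    ′-homo ⊥±    = sym 𝟘′≈𝟙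
    ′-homo ⊤±    = sym 𝟙′≈𝟘
    ′-homo [ a ] = refl

open AdjoinBounds using (adjoinBounds; adjoinBounds-quasiEq; collapse-isHomomorphism)

lemma3p15 : (c ℓ : Level) → VarietyGeneratedEqualsPKL c ℓ
lemma3p15 c ℓ s t = holdsIn𝒞⇒holdsInPKL , λ holdsInPKL A _ → holdsInPKL A
  where
  holdsIn𝒞⇒holdsInPKL : HoldsIn𝒞 c ℓ s t → HoldsInPKL c ℓ s t
  holdsIn𝒞⇒holdsInPKL holdsIn𝒞 A =
    satisfies-homomorphicImage (collapse-isHomomorphism A) [_] (λ _ → PseudoKleene.refl A) {s} {t}
      (holdsIn𝒞 (adjoinBounds A) (adjoinBounds-quasiEq A))
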